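{- Let $\mathcal{H}$ be a $2$-uniform hypergraph on which Maker wins the $(\ast,\ast)$-game (equivalently, $\theta(\mathcal{H})$ and $\tau(\mathcal{H})$ are finite). Then $\theta(\mathcal{H}) = \tau(\mathcal{H}) = 2$.
   Context: A hypergraph $\mathcal{H}$ consists of a finite vertex set $V(\mathcal{H})$ and a set $E(\mathcal{H})$ of subsets of $V(\mathcal{H})$ (edges); it is $k$-uniform if every edge has exactly $k$ vertices. For $a,b$ (nonnegative integers or $\ast$ = unlimited supply, enough to use a new token every turn), the $(a,b)$-game on $\mathcal{H}$: Maker has $a$ tokens and Breaker has $b$ tokens; initially the board is empty. Players alternate turns, Maker first. On a turn a player may pass, or place one of their own tokens on an unoccupied vertex, the token being either not yet used or moved from its current vertex on the board (which becomes unoccupied). Maker wins as soon as all vertices of some edge carry Maker tokens; Breaker wins if this never happens or if the game reaches the same state twice. The $(\ast,\ast)$-game is the classical Maker–Breaker game. $\theta(\mathcal{H})$ is the minimum $a$ such that Maker wins the $(a,\ast)$-game on $\mathcal{H}$ ($\infty$ if Breaker wins the $(\ast,\ast)$-game). $\tau(\mathcal{H})$ is the minimum $t$ such that Maker has a strategy in the $(\ast,\ast)$-game on $\mathcal{H}$ guaranteeing that she fills an edge having played at most $t$ moves ($\infty$ if Breaker wins the $(\ast,\ast)$-game). -}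

module Defs where

open import Data.Nat using (ℕ; zero; suc; _<_)
open import Data.Fin using (Fin)
open import Data.Fin.Subset using (Subset; _∈_; ∣_∣)
open import Data.Vec using (Vec; []; _∷_; lookup; replicate; _[_]≔_)
open import Data.List using (List; []; _∷_)
open import Data.List.Relation.Unary.All using (All)
open import Data.List.Relation.Unary.Any using (Any)
import Data.List.Membership.Propositional as LM
open import Data.Maybe using (Maybe; just; nothing)
open import Data.Product using (Σ; _×_; _,_)
open import Data.Sum using (_⊎_)
open import Data.Unit using (⊤)
open import Relation.Nullary using (¬_)
open import Relation.Binary.PropositionalEquality using (_≡_)

record Hypergraph : Set where
  field
    n     : ℕ
    edges : List (Subset n)
open Hypergraph public

Uniform : ℕ → Hypergraph → Set
Uniform k H = All (λ e → ∣ e ∣ ≡ k) (edges H)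

-- Budgets: a natural number, or ∗ (unlimited).  Used both for the
-- number of tokens and for the limit on the number of Maker moves.

data ℕ∗ : Set where
  fin : ℕ → ℕ∗
  ∗   : ℕ∗

_<∗_ : ℕ → ℕ∗ → Set
m <∗ fin a = m < a
m <∗ ∗     = ⊤

data Player : Set where
  maker breaker : Player

Cell : Set
Cell = Maybe Player

Board : ℕ → Set
Board n = Vec Cell n

emptyBoard : (n : ℕ) → Board n
emptyBoard n = replicate n nothing

samePlayer : Player → Cell → ℕ → ℕ
samePlayer maker   (just maker)   k = suc k
samePlayer breaker (just breaker) k = suc k
samePlayer _       _              k = k

tokens : ∀ {n} → Player → Board n → ℕ
tokens p []       = 0
tokens p (c ∷ cs) = samePlayer p c (tokens p cs)

data Step {n : ℕ} (p : Player) (a : ℕ∗) (b : Board n) : Board n → Set where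
  pass  : Step p a b b
  place : (v : Fin n) → lookup b v ≡ nothing → tokens p b <∗ a →
          Step p a b (b [ v ]≔ just p)
  shift : (u v : Fin n) → lookup b u ≡ just p → lookup b v ≡ nothing →
          Step p a b ((b [ u ]≔ nothing) [ v ]≔ just p)

Filled : (H : Hypergraph) → Board (n H) → Set
Filled H b = Any (λ e → ∀ v → v ∈ e → lookup b v ≡ just maker) (edges H)

State : ℕ → Set
State n = Player × Board n

-- Winning strategies for Maker in the (a,b)-game on H, where Maker may
-- make at most `lim` moves (turns, passes included); lim = ∗ : no limit.
-- `hist` lists all states reached so far (including the current one);
-- reaching a state in `hist` again is a win for Breaker.

decr : ℕ∗ → ℕ∗
decr (fin zero)    = fin zero
decr (fin (suc t)) = fin t
decr ∗             = ∗

canMove : ℕ∗ → Set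
canMove (fin t) = 0 < t
canMove ∗       = ⊤

module _ (H : Hypergraph) (a b : ℕ∗) where
  mutual
    data WinM (lim : ℕ∗) (hist : List (State (n H))) (s : Board (n H)) : Set where
      move : canMove lim → (s' : Board (n H)) → Step maker a s s' →
             (Filled H s' ⊎
               (¬ ((breaker , s') LM.∈ hist) ×
                WinB (decr lim) ((breaker , s') ∷ hist) s')) →
             WinM lim hist s

    data WinB (lim : ℕ∗) (hist : List (State (n H))) (s : Board (n H)) : Set where
      answers : (∀ s' → Step breaker b s s' →
                   ¬ ((maker , s') LM.∈ hist) ×
                   WinM lim ((maker , s') ∷ hist) s') →
                WinB lim hist s

MakerWins : (H : Hypergraph) → (a b lim : ℕ∗) → Set
MakerWins H a b lim =
  WinM H a b lim ((maker , emptyBoard (n H)) ∷ []) (emptyBoard (n H))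

θ≡ : Hypergraph → ℕ → Set
θ≡ H k = MakerWins H (fin k) ∗ ∗ × (∀ a → a < k → ¬ MakerWins H (fin a) ∗ ∗)

τ≡ : Hypergraph → ℕ → Set
τ≡ H k = MakerWins H ∗ ∗ (fin k) × (∀ t → t < k → ¬ MakerWins H ∗ ∗ (fin t))

{-# OPTIONS --safe #-}
module Submission where

-- Maker needs both vertices of a 2-edge, and a Maker turn adds at most one Maker token, so
-- neither one token nor one move can win: θ ≥ 2 and τ ≥ 2.  If two distinct edges {v, u}
-- and {v, w} meet, Maker takes v and then whichever of u, w Breaker has left free, which
-- uses two tokens in two moves.  Otherwise the edges are pairwise disjoint, and Breaker
-- wins by pairing, answering every Maker token with the other vertex of its edge; this
-- contradicts the hypothesis that Maker wins.

open import Defs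
open import Data.Bool using () renaming (_≟_ to _≟ᵇ_)
open import Data.Empty using (⊥-elim)
open import Data.Fin using (Fin; zero; suc; _≟_)
open import Data.Fin.Properties using (any?)
open import Data.Fin.Subset using (Subset; _∈_; _∉_; ∣_∣; ⁅_⁆; _-_; _⊆_; ⊥; Nonempty; inside; outside)
open import Data.Fin.Subset.Properties
  using (_∈?_; ∣⊥∣≡0; ∣⁅x⁆∣≡1; x∈⁅x⁆; ⊆-antisym; p⊆q⇒∣p∣≤∣q∣; x∈p⇒∣p-x∣<∣p∣; x∈p∧x≢y⇒x∈p-y)
open import Data.List using ([]; _∷_)
open import Data.List.Membership.Propositional using (find; lose) renaming (_∈_ to _∈ₗ_)
import Data.List.Relation.Unary.All as All
open import Data.List.Relation.Unary.Any as Any using (Any)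
open import Data.Maybe using (just; nothing)
open import Data.Maybe.Properties using (just-injective)
open import Data.Nat using (ℕ; zero; suc; _+_; _≤_; _<_; z≤n; s≤s)
open import Data.Nat.Properties
  using (≤-refl; ≤-reflexive; ≤-trans; n≤1+n; n<1+n; m≤m+n; +-suc; +-monoˡ-≤; <⇒≤; <⇒≱; ≤-<-trans
        ; module ≤-Reasoning)
open import Data.Product using (_×_; _,_; ∃-syntax; proj₂)
import Data.Product as Product
open import Data.Sum using (_⊎_; inj₁; inj₂)
import Data.Sum as Sum
open import Data.Unit using (tt)
open import Data.Vec using ([]; _∷_; here; there; lookup; _[_]≔_)
open import Data.Vec.Properties using (lookup∘update; lookup∘update′; lookup-replicate; ≡-dec)
open import Relation.Nullary using (¬_; Dec; yes; no; ¬?; contradiction)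
open import Relation.Nullary.Decidable using (_×-dec_; decidable-stable)
open import Relation.Binary.PropositionalEquality using (_≡_; _≢_; refl; sym; trans; cong; subst; module ≡-Reasoning)
open import Function using (_∘_)

private variable
  m k t : ℕ
  p q : Player
  a b lim : ℕ∗
  c c′ d : Cell
  s s′ : Board m
  u v w x y z : Fin m
  e f : Subset m

∣f∣<∣e∣⇒∃∈e∉f : ∣ f ∣ < ∣ e ∣ → ∃[ x ] x ∈ e × x ∉ f
∣f∣<∣e∣⇒∃∈e∉f {f = f} {e = e} f<e with any? (λ x → x ∈? e ×-dec ¬? (x ∈? f))
... | yes found = found
... | no none = contradiction (p⊆q⇒∣p∣≤∣q∣ e⊆f) (<⇒≱ f<e)
  where
  e⊆f : e ⊆ f
  e⊆f {x} x∈e = decidable-stable (x ∈? f) λ x∉f → none (x , x∈e , x∉f)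

0<∣e∣⇒Nonempty : 0 < ∣ e ∣ → Nonempty e
0<∣e∣⇒Nonempty {m} {e} lt with ∣f∣<∣e∣⇒∃∈e∉f {f = ⊥} (subst (_< ∣ e ∣) (sym (∣⊥∣≡0 m)) lt)
... | x , x∈e , _ = x , x∈e

1<∣e∣⇒∃≢ : 1 < ∣ e ∣ → (v : Fin m) → ∃[ x ] x ∈ e × x ≢ v
1<∣e∣⇒∃≢ {e = e} lt v with ∣f∣<∣e∣⇒∃∈e∉f {f = ⁅ v ⁆} (subst (_< ∣ e ∣) (sym (∣⁅x⁆∣≡1 v)) lt)
... | x , x∈e , x∉⁅v⁆ = x , x∈e , λ { refl → x∉⁅v⁆ (x∈⁅x⁆ v) }

distinct³⇒3≤∣e∣ : x ∈ e → y ∈ e → z ∈ e → y ≢ x → z ≢ x → z ≢ y → 3 ≤ ∣ e ∣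
distinct³⇒3≤∣e∣ {x = x} {e = e} {y = y} {z = z} x∈e y∈e z∈e y≢x z≢x z≢y = begin
  3                     ≤⟨ s≤s (s≤s (s≤s z≤n)) ⟩
  3 + ∣ e - x - y - z ∣ ≤⟨ s≤s (s≤s (x∈p⇒∣p-x∣<∣p∣ z∈e-x-y)) ⟩
  2 + ∣ e - x - y ∣     ≤⟨ s≤s (x∈p⇒∣p-x∣<∣p∣ y∈e-x) ⟩
  1 + ∣ e - x ∣         ≤⟨ x∈p⇒∣p-x∣<∣p∣ x∈e ⟩
  ∣ e ∣                 ∎
  where
  open ≤-Reasoning
  y∈e-x : y ∈ e - x
  y∈e-x = x∈p∧x≢y⇒x∈p-y y∈e y≢x
  z∈e-x-y : z ∈ e - x - y
  z∈e-x-y = x∈p∧x≢y⇒x∈p-y (x∈p∧x≢y⇒x∈p-y z∈e z≢x) z≢y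

Within : Fin m → Fin m → Subset m → Set
Within x y e = ∀ z → z ∈ e → z ≡ x ⊎ z ≡ y

within⇒⊆ : Within x y e → x ∈ f → y ∈ f → e ⊆ f
within⇒⊆ within x∈f y∈f {z} z∈e with within z z∈e
... | inj₁ refl = x∈f
... | inj₂ refl = y∈f

∣e∣≡2⇒pair : ∣ e ∣ ≡ 2 → x ∈ e → ∃[ y ] y ∈ e × y ≢ x × Within x y e
∣e∣≡2⇒pair {x = x} size x∈e with 1<∣e∣⇒∃≢ (≤-reflexive (sym size)) x
... | y , y∈e , y≢x = y , y∈e , y≢x , within
  where
  within : Within x y _
  within z z∈e with z ≟ x | z ≟ y
  ... | yes z≡x | _       = inj₁ z≡x
  ... | no _    | yes z≡y = inj₂ z≡y
  ... | no z≢x  | no z≢y  =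
    contradiction (subst (3 ≤_) size (distinct³⇒3≤∣e∣ x∈e y∈e z∈e y≢x z≢x z≢y)) (<⇒≱ (n<1+n 2))

lookup-≢ : (s : Board m) → lookup s x ≡ c → lookup s y ≡ d → c ≢ d → x ≢ y
lookup-≢ s sx sy c≢d refl = c≢d (trans (sym sx) sy)

lookup-update-keeps : (s : Board m) → c ≢ d → lookup s x ≡ c → lookup s y ≡ d →
  lookup (s [ y ]≔ c′) x ≡ c
lookup-update-keeps {c′ = c′} s c≢d sx sy = trans (lookup∘update′ (lookup-≢ s sx sy c≢d) s c′) sx

lookup-update-reflects : (s : Board m) (y : Fin m) → d ≢ c → lookup (s [ y ]≔ c) x ≡ d → lookup s x ≡ d
lookup-update-reflects {c = c} s y d≢c s′x =
  trans (sym (lookup∘update′ (lookup-≢ (s [ y ]≔ c) s′x (lookup∘update y s c) d≢c) s c)) s′x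

occupied≢empty : lookup s x ≡ just p → s ≢ emptyBoard m
occupied≢empty {x = x} sx refl = contradiction (trans (sym sx) (lookup-replicate x nothing)) λ ()

step-keeps-others : q ≢ p → Step q a s s′ → lookup s x ≡ just p → lookup s′ x ≡ just p
step-keeps-others q≢p pass sx = sx
step-keeps-others {s = s} q≢p (place _ sy _) sx = lookup-update-keeps s (λ ()) sx sy
step-keeps-others {s = s} q≢p (shift u _ su sv) sx =
  lookup-update-keeps (s [ u ]≔ nothing) (λ ())
    (lookup-update-keeps s (q≢p ∘ sym ∘ just-injective) sx su)
    (lookup-update-keeps s (λ ()) sv su)

update-keeps-one-free : (s : Board m) (y : Fin m) → u ≢ w → lookup s u ≡ nothing → lookup s w ≡ nothing →
  lookup (s [ y ]≔ c) u ≡ nothing ⊎ lookup (s [ y ]≔ c) w ≡ nothing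
update-keeps-one-free {u = u} {c = c} s y u≢w su sw with u ≟ y
... | yes refl = inj₂ (trans (lookup∘update′ (u≢w ∘ sym) s c) sw)
... | no u≢y   = inj₁ (trans (lookup∘update′ u≢y s c) su)

step-keeps-one-free : u ≢ w → Step p a s s′ → lookup s u ≡ nothing → lookup s w ≡ nothing →
  lookup s′ u ≡ nothing ⊎ lookup s′ w ≡ nothing
step-keeps-one-free u≢w pass su sw = inj₁ su
step-keeps-one-free {s = s} u≢w (place y _ _) su sw = update-keeps-one-free s y u≢w su sw
step-keeps-one-free {s = s} u≢w (shift x y sx _) su sw =
  update-keeps-one-free (s [ x ]≔ nothing) y u≢w
    (lookup-update-keeps s (λ ()) su sx) (lookup-update-keeps s (λ ()) sw sx)

step-gains-at-most-one : Step p a s s′ →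
  (∀ {x} → lookup s′ x ≡ just p → lookup s x ≡ just p) ⊎
  ∃[ v ] (∀ {x} → x ≢ v → lookup s′ x ≡ just p → lookup s x ≡ just p)
step-gains-at-most-one pass = inj₁ λ s′x → s′x
step-gains-at-most-one {s = s} (place v _ _) = inj₂ (v , λ x≢v → trans (sym (lookup∘update′ x≢v s _)))
step-gains-at-most-one {s = s} (shift u v _ _) =
  inj₂ (v , λ x≢v s′x → lookup-update-reflects s u (λ ())
              (trans (sym (lookup∘update′ x≢v (s [ u ]≔ nothing) _)) s′x))

samePlayer-suc : ∀ p c k → samePlayer p c (suc k) ≡ suc (samePlayer p c k)
samePlayer-suc maker   nothing        k = refl
samePlayer-suc maker   (just maker)   k = refl
samePlayer-suc maker   (just breaker) k = refl
samePlayer-suc breaker nothing        k = refl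
samePlayer-suc breaker (just maker)   k = refl
samePlayer-suc breaker (just breaker) k = refl

samePlayer-other : c ≢ just p → samePlayer p c k ≡ k
samePlayer-other {nothing}      {maker}   _   = refl
samePlayer-other {just maker}   {maker}   c≢p = contradiction refl c≢p
samePlayer-other {just breaker} {maker}   _   = refl
samePlayer-other {nothing}      {breaker} _   = refl
samePlayer-other {just maker}   {breaker} _   = refl
samePlayer-other {just breaker} {breaker} c≢p = contradiction refl c≢p

samePlayer-self : ∀ p k → samePlayer p (just p) k ≡ suc k
samePlayer-self maker   k = refl
samePlayer-self breaker k = refl

k≤samePlayer : ∀ p c k → k ≤ samePlayer p c k
k≤samePlayer maker   (just maker)   k = n≤1+n k
k≤samePlayer breaker (just breaker) k = n≤1+n k
k≤samePlayer maker   (just breaker) k = ≤-refl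
k≤samePlayer breaker (just maker)   k = ≤-refl
k≤samePlayer maker   nothing        k = ≤-refl
k≤samePlayer breaker nothing        k = ≤-refl

tokens-empty : ∀ p m → tokens p (emptyBoard m) ≡ 0
tokens-empty p zero    = refl
tokens-empty p (suc m) = trans (samePlayer-other (λ ())) (tokens-empty p m)

tokens-place : (s : Board m) → lookup s v ≡ nothing → tokens p (s [ v ]≔ just p) ≡ suc (tokens p s)
tokens-place {v = zero}  {p = maker}   (_ ∷ _) refl = refl
tokens-place {v = zero}  {p = breaker} (_ ∷ _) refl = refl
tokens-place {v = suc v} {p = p}       (c ∷ s) sv   =
  trans (cong (samePlayer p c) (tokens-place s sv)) (samePlayer-suc p c _)

tokens-clear : (s : Board m) → lookup s u ≡ just p → tokens p s ≡ suc (tokens p (s [ u ]≔ nothing))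
tokens-clear {u = zero}  {p = maker}   (_ ∷ _) refl = refl
tokens-clear {u = zero}  {p = breaker} (_ ∷ _) refl = refl
tokens-clear {u = suc u} {p = p}       (c ∷ s) su   =
  trans (cong (samePlayer p c) (tokens-clear s su)) (samePlayer-suc p c _)

tokens-update-other : (s : Board m) (y : Fin m) (c : Cell) → c ≢ just p → d ≢ just p → lookup s y ≡ d →
  tokens p (s [ y ]≔ c) ≡ tokens p s
tokens-update-other (_ ∷ _) zero c c≢p d≢p refl = trans (samePlayer-other c≢p) (sym (samePlayer-other d≢p))
tokens-update-other {p = p} (c₀ ∷ s) (suc y) c c≢p d≢p sy =
  cong (samePlayer p c₀) (tokens-update-other s y c c≢p d≢p sy)

tokens-shift : (s : Board m) → lookup s u ≡ just p → lookup s v ≡ nothing →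
  tokens p ((s [ u ]≔ nothing) [ v ]≔ just p) ≡ tokens p s
tokens-shift {u = u} s su sv =
  trans (tokens-place (s [ u ]≔ nothing) (lookup-update-keeps s (λ ()) sv su)) (sym (tokens-clear s su))

tokens-step≤ : Step p a s s′ → tokens p s′ ≤ suc (tokens p s)
tokens-step≤             pass               = n≤1+n _
tokens-step≤ {s = s}     (place _ sv _)     = ≤-reflexive (tokens-place s sv)
tokens-step≤ {s = s}     (shift _ _ su sv)  = ≤-trans (≤-reflexive (tokens-shift s su sv)) (n≤1+n _)

tokens-step-within : Step p (fin k) s s′ → tokens p s ≤ k → tokens p s′ ≤ k
tokens-step-within         pass              bound = bound
tokens-step-within {s = s} (place _ sv room) _     = ≤-trans (≤-reflexive (tokens-place s sv)) room
tokens-step-within {s = s} (shift _ _ su sv) bound = ≤-trans (≤-reflexive (tokens-shift s su sv)) bound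

tokens-step-other : q ≢ p → Step q a s s′ → tokens p s′ ≡ tokens p s
tokens-step-other q≢p pass = refl
tokens-step-other {q = q} {s = s} q≢p (place y sy _) =
  tokens-update-other s y (just q) (q≢p ∘ just-injective) (λ ()) sy
tokens-step-other {q = q} {s = s} q≢p (shift u v su sv) =
  trans (tokens-update-other (s [ u ]≔ nothing) v (just q) (q≢p ∘ just-injective) (λ ())
                             (lookup-update-keeps s (λ ()) sv su))
        (tokens-update-other s u nothing (λ ()) (q≢p ∘ just-injective) su)

tokens+moves-step : Step p a s s′ → tokens p s + suc t < k → tokens p s′ + t < k
tokens+moves-step {p = p} {s = s} {t = t} {k = k} step bound =
  ≤-<-trans (+-monoˡ-≤ t (tokens-step≤ step)) (subst (_< k) (+-suc (tokens p s) t) bound)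

∣e∣≤tokens : (s : Board m) → (∀ x → x ∈ e → lookup s x ≡ just p) → ∣ e ∣ ≤ tokens p s
∣e∣≤tokens {e = []}          []      _    = z≤n
∣e∣≤tokens {e = outside ∷ e} {p = p} (c ∷ s) full =
  ≤-trans (∣e∣≤tokens s (λ x x∈e → full (suc x) (there x∈e))) (k≤samePlayer p c _)
∣e∣≤tokens {e = inside ∷ e}  {p = p} (c ∷ s) full with full zero here
... | refl =
  ≤-trans (s≤s (∣e∣≤tokens s (λ x x∈e → full (suc x) (there x∈e)))) (≤-reflexive (sym (samePlayer-self p _)))

filled⇒k≤tokens : {H : Hypergraph} → Uniform k H → (s : Board (n H)) → Filled H s → k ≤ tokens maker s
filled⇒k≤tokens uniform s filled with All.lookupAny uniform filled
... | size , full = subst (_≤ tokens maker s) size (∣e∣≤tokens s full)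

-- Lower bounds on k-uniform hypergraphs

module _ {H : Hypergraph} (uniform : Uniform k H) where

  fewTokens⇒¬WinM : ∀ {hist} {s : Board (n H)} → t < k → tokens maker s ≤ t → ¬ WinM H (fin t) b lim hist s
  fewTokens⇒¬WinM t<k bound (move _ s′ step (inj₁ filled)) =
    <⇒≱ t<k (≤-trans (filled⇒k≤tokens uniform s′ filled) (tokens-step-within step bound))
  fewTokens⇒¬WinM t<k bound (move _ s′ step (inj₂ (_ , answers reply))) =
    fewTokens⇒¬WinM t<k (tokens-step-within step bound) (proj₂ (reply s′ pass))

  fewMoves⇒¬WinM : ∀ {hist} {s : Board (n H)} → tokens maker s + t < k → ¬ WinM H a b (fin t) hist s
  fewMoves⇒¬WinM {t = zero} _ (move () _ _ _)
  fewMoves⇒¬WinM {t = suc t} bound (move _ s′ step (inj₁ filled)) =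
    <⇒≱ (tokens+moves-step step bound) (≤-trans (filled⇒k≤tokens uniform s′ filled) (m≤m+n _ t))
  fewMoves⇒¬WinM {t = suc t} bound (move _ s′ step (inj₂ (_ , answers reply))) =
    fewMoves⇒¬WinM (tokens+moves-step step bound) (proj₂ (reply s′ pass))

  θ-lowerBound : t < k → ¬ MakerWins H (fin t) b lim
  θ-lowerBound t<k = fewTokens⇒¬WinM t<k (≤-trans (≤-reflexive (tokens-empty maker (n H))) z≤n)

  τ-lowerBound : t < k → ¬ MakerWins H a b (fin t)
  τ-lowerBound {t} t<k = fewMoves⇒¬WinM (subst (λ z → z + t < k) (sym (tokens-empty maker (n H))) t<k)

-- Maker's strategy on a cherry

record Cherry (H : Hypergraph) : Set where
  field
    centre left right : Fin (n H)
    left≢centre  : left ≢ centre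
    right≢centre : right ≢ centre
    left≢right   : left ≢ right
    leftEdge     : Any (Within centre left) (edges H)
    rightEdge    : Any (Within centre right) (edges H)

module _ {H : Hypergraph} where

  placing-fills : (s : Board (n H)) → lookup s x ≡ just maker → lookup s y ≡ nothing →
    Any (Within x y) (edges H) → Filled H (s [ y ]≔ just maker)
  placing-fills {x = x} {y = y} s sx sy = Any.map λ within z z∈e → fill (within z z∈e)
    where
    fill : ∀ {z} → z ≡ x ⊎ z ≡ y → lookup (s [ y ]≔ just maker) z ≡ just maker
    fill (inj₁ refl) = lookup-update-keeps s (λ ()) sx sy
    fill (inj₂ refl) = lookup∘update y s (just maker)

  completingMove : ∀ {hist} (s : Board (n H)) → canMove lim → tokens maker s <∗ a →
    lookup s x ≡ just maker → lookup s y ≡ nothing → Any (Within x y) (edges H) → WinM H a b lim hist s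
  completingMove {y = y} s canMove room sx sy edge =
    move canMove _ (place y sy room) (inj₁ (placing-fills s sx sy edge))

  cherry⇒MakerWins : Cherry H → 0 <∗ a → 1 <∗ a → canMove lim → canMove (decr lim) → MakerWins H a b lim
  cherry⇒MakerWins {a} {lim} {b} cherry room₀ room₁ move₁ move₂ =
    move move₁ s₁ (place centre (lookup-replicate centre nothing) room₀′) (inj₂ (s₁-new , answers reply))
    where
    open Cherry cherry
    s₀ s₁ : Board (n H)
    s₀ = emptyBoard (n H)
    s₁ = s₀ [ centre ]≔ just maker

    room₀′ : tokens maker s₀ <∗ a
    room₀′ = subst (_<∗ a) (sym (tokens-empty maker (n H))) room₀

    s₁-centre : lookup s₁ centre ≡ just maker
    s₁-centre = lookup∘update centre s₀ (just maker)

    s₁-free : ∀ {x} → x ≢ centre → lookup s₁ x ≡ nothing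
    s₁-free {x} x≢centre = trans (lookup∘update′ x≢centre s₀ (just maker)) (lookup-replicate x nothing)

    s₁-new : ¬ ((breaker , s₁) ∈ₗ (maker , s₀) ∷ [])
    s₁-new (Any.here ())

    reply : ∀ s₂ → Step breaker b s₁ s₂ →
      ¬ ((maker , s₂) ∈ₗ (breaker , s₁) ∷ (maker , s₀) ∷ []) ×
      WinM H a b (decr lim) ((maker , s₂) ∷ (breaker , s₁) ∷ (maker , s₀) ∷ []) s₂
    reply s₂ step =
      s₂-new , complete (step-keeps-one-free left≢right step (s₁-free left≢centre) (s₁-free right≢centre))
      where
      s₂-centre : lookup s₂ centre ≡ just maker
      s₂-centre = step-keeps-others (λ ()) step s₁-centre

      room₂ : tokens maker s₂ <∗ a
      room₂ = subst (_<∗ a) (sym tokens₂) room₁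
        where
        tokens₂ : tokens maker s₂ ≡ 1
        tokens₂ = begin
          tokens maker s₂       ≡⟨ tokens-step-other (λ ()) step ⟩
          tokens maker s₁       ≡⟨ tokens-place s₀ (lookup-replicate centre nothing) ⟩
          suc (tokens maker s₀) ≡⟨ cong suc (tokens-empty maker (n H)) ⟩
          1                     ∎
          where open ≡-Reasoning

      s₂-new : ¬ ((maker , s₂) ∈ₗ (breaker , s₁) ∷ (maker , s₀) ∷ [])
      s₂-new (Any.there (Any.here s₂≡s₀)) = occupied≢empty s₂-centre (cong proj₂ s₂≡s₀)

      complete : ∀ {hist} → lookup s₂ left ≡ nothing ⊎ lookup s₂ right ≡ nothing → WinM H a b (decr lim) hist s₂
      complete (inj₁ free) = completingMove s₂ move₂ room₂ s₂-centre free leftEdge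
      complete (inj₂ free) = completingMove s₂ move₂ room₂ s₂-centre free rightEdge

-- Breaker's pairing strategy on a matching

Matching : Hypergraph → Set
Matching H = ∀ {e e′} → e ∈ₗ edges H → e′ ∈ₗ edges H → ∀ {v} → v ∈ e → v ∈ e′ → e ≡ e′

HasBreaker : Board m → Subset m → Set
HasBreaker s e = ∃[ z ] z ∈ e × lookup s z ≡ just breaker

breaker? : (c : Cell) → Dec (c ≡ just breaker)
breaker? nothing        = no λ ()
breaker? (just maker)   = no λ ()
breaker? (just breaker) = yes refl

hasBreaker? : (s : Board m) (e : Subset m) → Dec (HasBreaker s e)
hasBreaker? s e = any? λ z → z ∈? e ×-dec breaker? (lookup s z)

full⇒¬HasBreaker : (s : Board m) → (∀ z → z ∈ e → lookup s z ≡ just maker) → ¬ HasBreaker s e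
full⇒¬HasBreaker s full (z , z∈e , sz) = contradiction (trans (sym (full z z∈e)) sz) λ ()

module _ {H : Hypergraph} where

  Blocked : Board (n H) → Set
  Blocked s = ∀ {e} → e ∈ₗ edges H → ∀ {x} → x ∈ e → lookup s x ≡ just maker → HasBreaker s e

  BlockedAwayFrom : Fin (n H) → Board (n H) → Set
  BlockedAwayFrom v s = ∀ {e} → e ∈ₗ edges H → ∀ {x} → x ∈ e → x ≢ v → lookup s x ≡ just maker → HasBreaker s e

  AlmostBlocked : Board (n H) → Set
  AlmostBlocked s = Blocked s ⊎ ∃[ v ] BlockedAwayFrom v s

  blocked-empty : Blocked (emptyBoard (n H))
  blocked-empty _ {x} _ empty-x = contradiction (trans (sym (lookup-replicate x nothing)) empty-x) λ ()

  makerStep-almostBlocked : {s s′ : Board (n H)} → Blocked s → Step maker a s s′ → AlmostBlocked s′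
  makerStep-almostBlocked {s = s} {s′} blocked step =
    Sum.map (λ old e∈ x∈e s′x → keep (blocked e∈ x∈e (old s′x)))
            (Product.map₂ λ old e∈ x∈e x≢v s′x → keep (blocked e∈ x∈e (old x≢v s′x)))
            (step-gains-at-most-one step)
    where
    keep : ∀ {e} → HasBreaker s e → HasBreaker s′ e
    keep (z , z∈e , sz) = z , z∈e , step-keeps-others (λ ()) step sz

  module _ (large : ∀ {e} → e ∈ₗ edges H → 1 < ∣ e ∣) where

    almostBlocked⇒¬Filled : (s : Board (n H)) → AlmostBlocked s → ¬ Filled H s
    almostBlocked⇒¬Filled s almost filled with find filled
    ... | e , e∈ , full with almost
    ...   | inj₁ blocked with 0<∣e∣⇒Nonempty (<⇒≤ (large e∈))
    ...     | x , x∈e = full⇒¬HasBreaker s full (blocked e∈ x∈e (full x x∈e))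
    almostBlocked⇒¬Filled s almost filled
        | e , e∈ , full | inj₂ (v , away) with 1<∣e∣⇒∃≢ (large e∈) v
    ...   | x , x∈e , x≢v = full⇒¬HasBreaker s full (away e∈ x∈e x≢v (full x x∈e))

    module _ (matching : Matching H) where

      -- v lies in at most one edge, so blocking an unblocked edge through v restores Blocked.
      blockAround : {s : Board (n H)} (v : Fin (n H)) → BlockedAwayFrom v s →
        ∃[ s′ ] Step breaker ∗ s s′ × Blocked s′
      blockAround {s} v away with Any.any? (λ e → v ∈? e ×-dec ¬? (hasBreaker? s e)) (edges H)
      ... | no ¬unblocked = s , pass , blocked
        where
        blocked : Blocked s
        blocked {e} e∈ {x} x∈e sx with x ≟ v
        ... | no x≢v  = away e∈ x∈e x≢v sx
        ... | yes refl = decidable-stable (hasBreaker? s e) λ ¬hb → ¬unblocked (lose e∈ (x∈e , ¬hb))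
      ... | yes unblocked with find unblocked
      ... | e₀ , e₀∈ , v∈e₀ , ¬hb₀ with 1<∣e∣⇒∃≢ (large e₀∈) v
      ... | y , y∈e₀ , y≢v = s [ y ]≔ just breaker , place y sy tt , blocked
        where
        sy : lookup s y ≡ nothing
        sy with lookup s y in eq
        ... | nothing      = refl
        ... | just maker   = contradiction (away e₀∈ y∈e₀ y≢v eq) ¬hb₀
        ... | just breaker = contradiction (y , y∈e₀ , eq) ¬hb₀
        blocked : Blocked (s [ y ]≔ just breaker)
        blocked {e} e∈ {x} x∈e s′x with x ≟ v
        ... | yes refl = y , subst (y ∈_) (matching e₀∈ e∈ v∈e₀ x∈e) y∈e₀ , lookup∘update y s (just breaker)
        ... | no x≢v with away e∈ x∈e x≢v (lookup-update-reflects s y (λ ()) s′x)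
        ...   | z , z∈e , sz = z , z∈e , lookup-update-keeps s (λ ()) sz sy

      breakerReply : {s : Board (n H)} → AlmostBlocked s → ∃[ s′ ] Step breaker ∗ s s′ × Blocked s′
      breakerReply {s} (inj₁ blocked)    = s , pass , blocked
      breakerReply     (inj₂ (v , away)) = blockAround v away

      blocked⇒¬WinM : ∀ {hist} {s : Board (n H)} → Blocked s → ¬ WinM H a ∗ lim hist s
      blocked⇒¬WinM blocked (move _ s′ step (inj₁ filled)) =
        almostBlocked⇒¬Filled s′ (makerStep-almostBlocked blocked step) filled
      blocked⇒¬WinM blocked (move _ _ step (inj₂ (_ , answers reply)))
        with s″ , reply-step , blocked″ ← breakerReply (makerStep-almostBlocked blocked step) =
        blocked⇒¬WinM blocked″ (proj₂ (reply s″ reply-step))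

      matching⇒¬MakerWins : ¬ MakerWins H a ∗ lim
      matching⇒¬MakerWins = blocked⇒¬WinM blocked-empty

module _ {H : Hypergraph} (uniform : Uniform 2 H) where

  meeting⇒Cherry : e ∈ₗ edges H → f ∈ₗ edges H → e ≢ f → v ∈ e → v ∈ f → Cherry H
  meeting⇒Cherry {v = v} e∈ f∈ e≢f v∈e v∈f
    with u , u∈e , u≢v , e-within ← ∣e∣≡2⇒pair (All.lookup uniform e∈) v∈e
       | w , w∈f , w≢v , f-within ← ∣e∣≡2⇒pair (All.lookup uniform f∈) v∈f
    = record
      { centre = v ; left = u ; right = w
      ; left≢centre = u≢v ; right≢centre = w≢v
      ; left≢right = λ { refl → e≢f (⊆-antisym (within⇒⊆ e-within v∈f w∈f) (within⇒⊆ f-within v∈e u∈e)) }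
      ; leftEdge = lose e∈ e-within ; rightEdge = lose f∈ f-within
      }

  Meet : Subset (n H) → Subset (n H) → Set
  Meet e f = e ≢ f × ∃[ v ] v ∈ e × v ∈ f

  meet? : ∀ e f → Dec (Meet e f)
  meet? e f = ¬? (≡-dec _≟ᵇ_ e f) ×-dec any? (λ v → v ∈? e ×-dec v ∈? f)

  matching⊎Cherry : Matching H ⊎ Cherry H
  matching⊎Cherry with Any.any? (λ e → Any.any? (meet? e) (edges H)) (edges H)
  ... | no ¬meet = inj₁ λ e∈ f∈ v∈e v∈f →
    decidable-stable (≡-dec _≟ᵇ_ _ _) λ e≢f → ¬meet (lose e∈ (lose f∈ (e≢f , _ , v∈e , v∈f)))
  ... | yes meet
    with e , e∈ , meets ← find meet
    with f , f∈ , e≢f , v , v∈e , v∈f ← find meets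
    = inj₂ (meeting⇒Cherry e∈ f∈ e≢f v∈e v∈f)

proposition4p2 : (H : Hypergraph) → Uniform 2 H → MakerWins H ∗ ∗ ∗ →
    θ≡ H 2 × τ≡ H 2
proposition4p2 H uniform makerWins with matching⊎Cherry uniform
... | inj₁ matching = ⊥-elim (matching⇒¬MakerWins large matching makerWins)
  where
  large : ∀ {e} → e ∈ₗ edges H → 1 < ∣ e ∣
  large e∈ = ≤-reflexive (sym (All.lookup uniform e∈))
... | inj₂ cherry =
  (cherry⇒MakerWins cherry (s≤s z≤n) (s≤s (s≤s z≤n)) tt tt , λ _ → θ-lowerBound uniform) ,
  (cherry⇒MakerWins cherry tt tt (s≤s z≤n) (s≤s z≤n) , λ _ → τ-lowerBound uniform)
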